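{- Let $p$ be a prime and let $r,m$ be positive integers. Any path in $X_m(p)$ has precisely $p^{(r-1)(m-2)}$ lifts to $X_m(p^r)$.
   Context: For a positive integer $n$, $\mathscr{E}_n$ is the directed graph whose vertices are pairs $(a,b)$ with $a,b\in\{0,\dots,n-1\}$ and $\gcd(a,b,n)=1$, written $a/b$ (integer representatives modulo $n$ may also be used), with a directed edge $a/b\to c/d$ iff $ad-bc\equiv1\pmod n$. A path of length $m$ is a sequence $\langle v_0,\dots,v_m\rangle$ of vertices with edges $v_{i-1}\to v_i$. Two vertices $u,v$ are equivalent if $u=\lambda v$ (componentwise) for some unit $\lambda$ of $\mathbb{Z}/n\mathbb{Z}$. $X_m(n)$ is the set of paths $\langle v_0,\dots,v_m\rangle$ of length $m$ in $\mathscr{E}_n$ with $v_0=1/0$, $v_1=0/1$ and $v_m$ equivalent to $v_0$. A lift to $X_m(p^r)$ of a path $\langle v_0,\dots,v_m\rangle\in X_m(p)$ is a path $\langle w_0,\dots,w_m\rangle\in X_m(p^r)$ such that reducing the numerator and denominator of $w_i$ modulo $p$ gives $v_i$ for every $i$. -}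

module Defs where

open import Data.Nat as ℕ using (ℕ; suc; _≤_; s≤s)
open import Data.Nat.GCD using (gcd)
open import Data.Integer as ℤ using (ℤ; +_; _-_; _*_)
open import Data.Integer.Divisibility as ℤD using ()
open import Data.Fin using (Fin; toℕ; fromℕ<; inject₁) renaming (zero to fz; suc to fs)
open import Data.Vec using (Vec; lookup)
open import Data.Product using (_×_; _,_; proj₁; proj₂; Σ; ∃)
open import Relation.Binary.PropositionalEquality using (_≡_)

_≡_[mod_] : ℤ → ℤ → ℕ → Set
x ≡ y [mod n ] = (+ n) ℤD.∣ (x - y)

-- A (raw) pair a/b with representatives a,b ∈ {0,…,n-1}.
Pair : ℕ → Set
Pair n = Fin n × Fin n

num den : ∀ {n} → Pair n → ℤ
num v = + toℕ (proj₁ v)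
den v = + toℕ (proj₂ v)

IsVertex : (n : ℕ) → Pair n → Set
IsVertex n v = gcd (gcd (toℕ (proj₁ v)) (toℕ (proj₂ v))) n ≡ 1

Edge : (n : ℕ) → Pair n → Pair n → Set
Edge n u v = (num u * den v - den u * num v) ≡ + 1 [mod n ]

Equiv : (n : ℕ) → Pair n → Pair n → Set
Equiv n u v = Σ (Fin n) λ l → gcd (toℕ l) n ≡ 1
  × (num u ≡ (+ toℕ l) * num v [mod n ])
  × (den u ≡ (+ toℕ l) * den v [mod n ])

Is1/0 : (n : ℕ) → Pair n → Set
Is1/0 n v = (num v ≡ + 1 [mod n ]) × (toℕ (proj₂ v) ≡ 0)

Is0/1 : (n : ℕ) → Pair n → Set
Is0/1 n v = (toℕ (proj₁ v) ≡ 0) × (den v ≡ + 1 [mod n ])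

IsPath : (n m : ℕ) → Vec (Pair n) (suc m) → Set
IsPath n m w = (∀ (i : Fin (suc m)) → IsVertex n (lookup w i))
  × (∀ (i : Fin m) → Edge n (lookup w (inject₁ i)) (lookup w (fs i)))

-- Membership in X_m(n) (m ≥ 1 so that v₁ exists).
InX : (n m : ℕ) → 1 ≤ m → Vec (Pair n) (suc m) → Set
InX n m 1≤m w = IsPath n m w
  × Is1/0 n (lookup w fz)
  × Is0/1 n (lookup w (fromℕ< (s≤s 1≤m)))
  × Equiv n (lookup w (Data.Fin.fromℕ m)) (lookup w fz)

Reduces : (p r m : ℕ) → Vec (Pair (p ℕ.^ r)) (suc m) → Vec (Pair p) (suc m) → Set
Reduces p r m w v = ∀ (i : Fin (suc m)) →
  (num (lookup w i) ≡ num (lookup v i) [mod p ]) × (den (lookup w i) ≡ den (lookup v i) [mod p ])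

IsLift : (p r m : ℕ) → 1 ≤ m → Vec (Pair p) (suc m) → Vec (Pair (p ℕ.^ r)) (suc m) → Set
IsLift p r m 1≤m v w = InX (p ℕ.^ r) m 1≤m w × Reduces p r m w v

{-# OPTIONS --safe #-}
-- A path 1/0 → 0/1 → v₂ → ⋯ → vₘ in 𝓔ₙ is determined modulo n by its skip determinants
-- cᵢ = det(vᵢ, vᵢ₊₂), i < m - 2: two consecutive edges u → v → w force w ≡ det(u,w) v - u
-- (Cramer's rule), and the last vertex (λ, 0) is forced by the last edge, λ ≡ -b⁻¹ where b is
-- the denominator of vₘ₋₁. Conversely, given v ∈ Xₘ(p), running the recurrence modulo pʳ with
-- any integers cᵢ ≡ det(vᵢ, vᵢ₊₂) (mod p) and closing with λ = -b⁻¹ gives a lift: b is a unit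
-- modulo p, hence modulo pʳ, and the new path agrees with v modulo p by the same rigidity read
-- modulo p. So the lifts correspond to the (pʳ⁻¹)ᵐ⁻² choices of residues cᵢ mod pʳ above the
-- cᵢ mod p.
module Submission where

module Congruence where

  open import Data.Nat.Base as ℕ using (ℕ; zero; suc; NonZero)
  import Data.Nat.Properties as ℕ
  import Data.Nat.Divisibility as ℕ
  import Data.Nat.DivMod as ℕ
  open import Data.Integer.Base using (ℤ; +_; _+_; _-_; _*_; -_; ∣_∣; _⊖_)
  import Data.Integer.Properties as ℤ
  import Data.Integer.Divisibility.Signed as Signed
  open import Data.Integer.DivMod using (_%ℕ_; _/ℕ_; n%ℕd<d; a≡a%ℕn+[a/ℕn]*n)
  open import Data.Integer.Tactic.RingSolver using (solve-∀)
  open import Data.Fin.Base as Fin using (Fin; toℕ; fromℕ<)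
  import Data.Fin.Properties as Finₚ
  open import Data.Product.Base using (Σ-syntax; _,_)
  open import Level using (0ℓ)
  open import Relation.Binary.Bundles using (Setoid)
  open import Relation.Binary.PropositionalEquality
  import Relation.Binary.Reasoning.Setoid as SetoidReasoning
  open import Defs using (_≡_[mod_])

  infix 4 _≋_[mod_]

  -- x ≡ y [mod n ] depends on x and y only through ∣ x - y ∣, so Agda cannot infer them
  -- from a proof; this wrapper keeps them as indices.
  record _≋_[mod_] (x y : ℤ) (n : ℕ) : Set where
    constructor mod
    field unmod : x ≡ y [mod n ]

  open _≋_[mod_] public

  private
    variable
      d n p q : ℕ
      x y z x′ y′ : ℤ

    by-difference : x - y ≡ z → + n Signed.∣ z → x ≋ y [mod n ]
    by-difference refl n∣z = mod (Signed.∣⇒∣ᵤ n∣z)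

    difference : x ≋ y [mod n ] → + n Signed.∣ (x - y)
    difference (mod x≡y) = Signed.∣ᵤ⇒∣ x≡y

    ≡0⇒∣ : x ≋ + 0 [mod n ] → n ℕ.∣ ∣ x ∣
    ≡0⇒∣ {x} {n} (mod x≡0) = subst (n ℕ.∣_) (cong ∣_∣ (ℤ.+-identityʳ x)) x≡0

    ∣⇒≡0 : n ℕ.∣ ∣ x ∣ → x ≋ + 0 [mod n ]
    ∣⇒≡0 {n} {x} n∣x = mod (subst (n ℕ.∣_) (cong ∣_∣ (sym (ℤ.+-identityʳ x))) n∣x)

    abs-*-difference : ∀ p x y → ∣ + p * x - + p * y ∣ ≡ p ℕ.* ∣ x - y ∣
    abs-*-difference p x y = trans (cong ∣_∣ (identity (+ p) x y)) (ℤ.abs-* (+ p) (x - y))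
      where
      identity : ∀ p x y → p * x - p * y ≡ p * (x - y)
      identity = solve-∀

  mod-reflexive : x ≡ y → x ≋ y [mod n ]
  mod-reflexive {x} {n = n} refl =
    mod (subst (λ t → n ℕ.∣ ∣ t ∣) (sym (ℤ.+-inverseʳ x)) (n ℕ.∣0))

  mod-refl : x ≋ x [mod n ]
  mod-refl = mod-reflexive refl

  mod-sym : x ≋ y [mod n ] → y ≋ x [mod n ]
  mod-sym {x} {y} {n} (mod x≡y) = mod (subst (n ℕ.∣_) (ℤ.∣i-j∣≡∣j-i∣ x y) x≡y)

  mod-trans : x ≋ y [mod n ] → y ≋ z [mod n ] → x ≋ z [mod n ]
  mod-trans {x} {y} {z = z} x≡y y≡z =
    by-difference (identity x y z) (Signed.∣m∣n⇒∣m+n (difference x≡y) (difference y≡z))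
    where
    identity : ∀ x y z → x - z ≡ (x - y) + (y - z)
    identity = solve-∀

  mod-setoid : ℕ → Setoid 0ℓ 0ℓ
  mod-setoid n = record
    { Carrier       = ℤ
    ; _≈_           = _≋_[mod n ]
    ; isEquivalence = record { refl = mod-refl ; sym = mod-sym ; trans = mod-trans }
    }

  module ≋-Reasoning (n : ℕ) = SetoidReasoning (mod-setoid n)

  mod-weaken : d ℕ.∣ n → x ≋ y [mod n ] → x ≋ y [mod d ]
  mod-weaken d∣n (mod x≡y) = mod (ℕ.∣-trans d∣n x≡y)

  mod-1 : x ≋ y [mod 1 ]
  mod-1 {x} {y} = mod (ℕ.1∣ ∣ x - y ∣)

  +-cong : x ≋ x′ [mod n ] → y ≋ y′ [mod n ] → x + y ≋ x′ + y′ [mod n ]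
  +-cong {x} {x′} {y = y} {y′} x≡x′ y≡y′ =
    by-difference (identity x y x′ y′) (Signed.∣m∣n⇒∣m+n (difference x≡x′) (difference y≡y′))
    where
    identity : ∀ x y x′ y′ → (x + y) - (x′ + y′) ≡ (x - x′) + (y - y′)
    identity = solve-∀

  neg-cong : x ≋ x′ [mod n ] → - x ≋ - x′ [mod n ]
  neg-cong {x} {x′} x≡x′ = by-difference (identity x x′) (Signed.∣m⇒∣-m (difference x≡x′))
    where
    identity : ∀ x x′ → (- x) - (- x′) ≡ - (x - x′)
    identity = solve-∀

  sub-cong : x ≋ x′ [mod n ] → y ≋ y′ [mod n ] → x - y ≋ x′ - y′ [mod n ]
  sub-cong x≡x′ y≡y′ = +-cong x≡x′ (neg-cong y≡y′)

  *-cong : x ≋ x′ [mod n ] → y ≋ y′ [mod n ] → x * y ≋ x′ * y′ [mod n ]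
  *-cong {x} {x′} {y = y} {y′} x≡x′ y≡y′ = by-difference (identity x y x′ y′)
    (Signed.∣m∣n⇒∣m+n (Signed.∣m⇒∣m*n y (difference x≡x′)) (Signed.∣n⇒∣m*n x′ (difference y≡y′)))
    where
    identity : ∀ x y x′ y′ → x * y - x′ * y′ ≡ (x - x′) * y + x′ * (y - y′)
    identity = solve-∀

  +-congˡ : ∀ x → y ≋ y′ [mod n ] → x + y ≋ x + y′ [mod n ]
  +-congˡ x = +-cong (mod-refl {x})

  sub-congˡ : ∀ x → y ≋ y′ [mod n ] → x - y ≋ x - y′ [mod n ]
  sub-congˡ x y≡y′ = +-congˡ x (neg-cong y≡y′)

  sub-congʳ : ∀ y → x ≋ x′ [mod n ] → x - y ≋ x′ - y [mod n ]
  sub-congʳ y x≡x′ = +-cong x≡x′ (mod-refl {x = - y})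

  *-congˡ : ∀ x → y ≋ y′ [mod n ] → x * y ≋ x * y′ [mod n ]
  *-congˡ x = *-cong (mod-refl {x})

  *-congʳ : ∀ y → x ≋ x′ [mod n ] → x * y ≋ x′ * y [mod n ]
  *-congʳ y x≡x′ = *-cong x≡x′ (mod-refl {y})

  +-cancelˡ : ∀ x → x + y ≋ x + y′ [mod n ] → y ≋ y′ [mod n ]
  +-cancelˡ {y} {y′} x (mod n∣) = mod (subst (_ ℕ.∣_) (cong ∣_∣ (identity x y y′)) n∣)
    where
    identity : ∀ x y y′ → (x + y) - (x + y′) ≡ y - y′
    identity = solve-∀

  +-multiple : ∀ x y → x + + p * y ≋ x [mod p ]
  +-multiple {p} x y = by-difference (identity x y (+ p)) (Signed.divides y refl)
    where
    identity : ∀ x y p → (x + p * y) - x ≡ y * p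
    identity = solve-∀

  *-monoˡ-mod : ∀ p → x ≋ y [mod q ] → + p * x ≋ + p * y [mod p ℕ.* q ]
  *-monoˡ-mod {x} {y} {q} p (mod q∣∣x-y∣) =
    mod (subst (p ℕ.* q ℕ.∣_) (sym (abs-*-difference p x y)) (ℕ.*-monoʳ-∣ p q∣∣x-y∣))

  *-cancelˡ-mod : ∀ p .{{_ : NonZero p}} → + p * x ≋ + p * y [mod p ℕ.* q ] → x ≋ y [mod q ]
  *-cancelˡ-mod {x} {y} {q} p (mod pq∣) =
    mod (ℕ.*-cancelˡ-∣ p (subst (p ℕ.* q ℕ.∣_) (abs-*-difference p x y) pq∣))

  *-pres-≡0 : x ≋ + 0 [mod n ] → y ≋ + 0 [mod d ] → x * y ≋ + 0 [mod n ℕ.* d ]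
  *-pres-≡0 {x} {y = y} x≡0 y≡0 =
    ∣⇒≡0 (subst (_ ℕ.∣_) (sym (ℤ.abs-* x y)) (ℕ.*-pres-∣ (≡0⇒∣ x≡0) (≡0⇒∣ y≡0)))

  ≡⇒difference≡0 : x ≋ y [mod n ] → x - y ≋ + 0 [mod n ]
  ≡⇒difference≡0 (mod x≡y) = ∣⇒≡0 x≡y

  difference≡0⇒≡ : x - y ≋ + 0 [mod n ] → x ≋ y [mod n ]
  difference≡0⇒≡ x-y≡0 = mod (≡0⇒∣ x-y≡0)

  common-divisor≡1 : d ℕ.∣ n → + d Signed.∣ x → x ≋ + 1 [mod n ] → d ≡ 1
  common-divisor≡1 {d} {x = x} d∣n d∣x x≡1 = ℕ.∣1⇒≡1 (Signed.∣⇒∣ᵤ d∣1)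
    where
    identity : ∀ x → x - (x - + 1) ≡ + 1
    identity = solve-∀
    d∣1 : + d Signed.∣ + 1
    d∣1 = subst (+ d Signed.∣_) (identity x)
      (Signed.∣m∣n⇒∣m-n d∣x (Signed.∣-trans (Signed.∣ᵤ⇒∣ d∣n) (difference x≡1)))

  inverse-unique : ∀ u → u * x ≋ + 1 [mod n ] → u * y ≋ + 1 [mod n ] → x ≋ y [mod n ]
  inverse-unique {x} {n} {y} u ux≡1 uy≡1 = begin
    x            ≡⟨ ℤ.*-identityʳ x ⟨
    x * + 1      ≈⟨ *-congˡ x uy≡1 ⟨
    x * (u * y)  ≡⟨ identity x u y ⟩
    (u * x) * y  ≈⟨ *-congʳ y ux≡1 ⟩
    + 1 * y      ≡⟨ ℤ.*-identityˡ y ⟩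
    y            ∎
    where
    open ≋-Reasoning n
    identity : ∀ x u y → x * (u * y) ≡ (u * x) * y
    identity = solve-∀

  liftInverse : ℤ → ℤ → ℕ → ℤ
  liftInverse u s zero    = + 0
  liftInverse u s (suc j) = t + s * (+ 1 - u * t)
    where
    t : ℤ
    t = liftInverse u s j

  -- Each step multiplies the error u t - 1 by 1 - u s ≡ 0 (mod n).
  liftInverse-inverts : ∀ u s → u * s ≋ + 1 [mod n ] →
                        ∀ j → u * liftInverse u s j ≋ + 1 [mod n ℕ.^ j ]
  liftInverse-inverts u s _    zero    = mod-1
  liftInverse-inverts u s us≡1 (suc j) = difference≡0⇒≡ (subst (_≋ + 0 [mod _ ]) (identity u s t)
    (*-pres-≡0 (≡⇒difference≡0 (mod-sym us≡1)) (≡⇒difference≡0 (liftInverse-inverts u s us≡1 j))))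
    where
    t : ℤ
    t = liftInverse u s j
    identity : ∀ u s t → (+ 1 - u * s) * (u * t - + 1) ≡ u * (t + s * (+ 1 - u * t)) - + 1
    identity = solve-∀

  reduce : ∀ n .{{_ : NonZero n}} → ℤ → Fin n
  reduce n x = fromℕ< (n%ℕd<d x n)

  reduce-≋ : ∀ n .{{_ : NonZero n}} x → + toℕ (reduce n x) ≋ x [mod n ]
  reduce-≋ n x = by-difference difference-is-multiple (Signed.divides (- (x /ℕ n)) refl)
    where
    identity : ∀ r q n → r - (r + q * n) ≡ - q * n
    identity = solve-∀
    difference-is-multiple : + toℕ (reduce n x) - x ≡ - (x /ℕ n) * + n
    difference-is-multiple = begin
      + toℕ (reduce n x) - x      ≡⟨ cong (λ r → + r - x) (Finₚ.toℕ-fromℕ< (n%ℕd<d x n)) ⟩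
      + r - x                     ≡⟨ cong (λ t → + r - t) (a≡a%ℕn+[a/ℕn]*n x n) ⟩
      + r - (+ r + x /ℕ n * + n)  ≡⟨ identity (+ r) (x /ℕ n) (+ n) ⟩
      - (x /ℕ n) * + n            ∎
      where
      open ≡-Reasoning
      r : ℕ
      r = x %ℕ n

  toℕ-injective-mod : ∀ {a b : Fin n} → + toℕ a ≋ + toℕ b [mod n ] → a ≡ b
  toℕ-injective-mod {suc n} {a} {b} (mod n∣∣a-b∣) =
    Finₚ.toℕ-injective (ℤ.+-injective (ℤ.i-j≡0⇒i≡j _ _ (ℤ.∣i∣≡0⇒i≡0 ∣a-b∣≡0)))
    where
    ∣a-b∣<n : ∣ + toℕ a - + toℕ b ∣ ℕ.< suc n
    ∣a-b∣<n = begin-strict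
      ∣ + toℕ a - + toℕ b ∣  ≡⟨ cong ∣_∣ (ℤ.[+m]-[+n]≡m⊖n (toℕ a) (toℕ b)) ⟩
      ∣ toℕ a ⊖ toℕ b ∣      ≤⟨ ℤ.∣m⊝n∣≤m⊔n (toℕ a) (toℕ b) ⟩
      toℕ a ℕ.⊔ toℕ b        <⟨ ℕ.⊔-lub (Finₚ.toℕ<n a) (Finₚ.toℕ<n b) ⟩
      suc n                  ∎
      where open ℕ.≤-Reasoning
    ∣a-b∣≡0 : ∣ + toℕ a - + toℕ b ∣ ≡ 0
    ∣a-b∣≡0 = trans (sym (ℕ.m<n⇒m%n≡m ∣a-b∣<n)) (ℕ.n∣m⇒m%n≡0 _ (suc n) n∣∣a-b∣)

  toℕ-≡0-mod : ∀ {a : Fin n} → + toℕ a ≋ + 0 [mod n ] → toℕ a ≡ 0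
  toℕ-≡0-mod {suc n} {a} a≡0 = cong toℕ (toℕ-injective-mod {a = a} {b = Fin.zero} a≡0)

  digit : ∀ q .{{_ : NonZero q}} → x ≋ y [mod p ] →
          Σ[ t ∈ Fin q ] x ≋ y + + p * + toℕ t [mod p ℕ.* q ]
  digit {x} {y} {p} q x≡y = t , (begin
    x                  ≡⟨ x≡y+pk ⟩
    y + + p * k        ≈⟨ +-congˡ y (*-monoˡ-mod p (mod-sym (reduce-≋ q k))) ⟩
    y + + p * + toℕ t  ∎)
    where
    open ≋-Reasoning (p ℕ.* q)
    k : ℤ
    k = Signed._∣_.quotient (difference x≡y)
    t : Fin q
    t = reduce q k
    identity : ∀ x y → x ≡ y + (x - y)
    identity = solve-∀
    x≡y+pk : x ≡ y + + p * k
    x≡y+pk = trans (identity x y)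
      (cong (_+_ y) (trans (Signed._∣_.equality (difference x≡y)) (ℤ.*-comm k (+ p))))

  digit-injective : ∀ p .{{_ : NonZero p}} y {s t : Fin q} →
                    y + + p * + toℕ s ≋ y + + p * + toℕ t [mod p ℕ.* q ] → s ≡ t
  digit-injective p y ys≡yt = toℕ-injective-mod (*-cancelˡ-mod p (+-cancelˡ y ys≡yt))


module UnimodularPaths where

  open import Data.Nat.Base as ℕ using (ℕ; zero; suc)
  import Data.Nat.Divisibility as ℕ
  open import Data.Integer.Base using (ℤ; +_; _-_; _*_; -_)
  import Data.Integer.Properties as ℤ
  open import Data.Integer.Tactic.RingSolver using (solve-∀)
  open import Data.Fin.Base using (zero; suc; fromℕ)
  open import Data.Vec.Base using (Vec; []; _∷_; lookup)
  open import Data.Vec.Relation.Unary.Linked as Linked using (Linked; [-]; _∷_)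
  open import Data.Vec.Relation.Binary.Pointwise.Inductive as Pointwise using (Pointwise; []; _∷_)
  open import Data.Product.Base using (_×_; _,_; proj₁; proj₂)
  open import Relation.Binary.PropositionalEquality
  open Congruence

  private
    variable
      d k n : ℕ
      y y′ : ℤ

  ℤ² : Set
  ℤ² = ℤ × ℤ

  1/0 0/1 : ℤ²
  1/0 = + 1 , + 0
  0/1 = + 0 , + 1

  det : ℤ² → ℤ² → ℤ
  det u v = proj₁ u * proj₂ v - proj₂ u * proj₁ v

  infix 4 _≋²_[mod_]

  _≋²_[mod_] : ℤ² → ℤ² → ℕ → Set
  u ≋² v [mod n ] = proj₁ u ≋ proj₁ v [mod n ] × proj₂ u ≋ proj₂ v [mod n ]

  private
    variable
      a a′ b b′ u u′ v v′ z z′ : ℤ²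

  ≋²-refl : u ≋² u [mod n ]
  ≋²-refl = mod-refl , mod-refl

  ≋²-sym : u ≋² v [mod n ] → v ≋² u [mod n ]
  ≋²-sym (u₁≡v₁ , u₂≡v₂) = mod-sym u₁≡v₁ , mod-sym u₂≡v₂

  ≋²-trans : u ≋² v [mod n ] → v ≋² z [mod n ] → u ≋² z [mod n ]
  ≋²-trans (u₁≡v₁ , u₂≡v₂) (v₁≡z₁ , v₂≡z₂) = mod-trans u₁≡v₁ v₁≡z₁ , mod-trans u₂≡v₂ v₂≡z₂

  ≋²-weaken : d ℕ.∣ n → u ≋² v [mod n ] → u ≋² v [mod d ]
  ≋²-weaken d∣n (u₁≡v₁ , u₂≡v₂) = mod-weaken d∣n u₁≡v₁ , mod-weaken d∣n u₂≡v₂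

  det-cong : u ≋² u′ [mod n ] → v ≋² v′ [mod n ] → det u v ≋ det u′ v′ [mod n ]
  det-cong (u₁≡ , u₂≡) (v₁≡ , v₂≡) = sub-cong (*-cong u₁≡ v₂≡) (*-cong u₂≡ v₁≡)

  Unimodular : ℕ → ℤ² → ℤ² → Set
  Unimodular n u v = det u v ≋ + 1 [mod n ]

  nextVertex : ℤ → ℤ² → ℤ² → ℤ²
  nextVertex y a b = y * proj₁ b - proj₁ a , y * proj₂ b - proj₂ a

  nextVertex-cong : y ≋ y′ [mod n ] → a ≋² a′ [mod n ] → b ≋² b′ [mod n ] →
                    nextVertex y a b ≋² nextVertex y′ a′ b′ [mod n ]
  nextVertex-cong y≡ (a₁≡ , a₂≡) (b₁≡ , b₂≡) =
    sub-cong (*-cong y≡ b₁≡) a₁≡ , sub-cong (*-cong y≡ b₂≡) a₂≡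

  det-nextVertex : ∀ y a b → det b (nextVertex y a b) ≡ det a b
  det-nextVertex y (a₁ , a₂) (b₁ , b₂) = identity y a₁ a₂ b₁ b₂
    where
    identity : ∀ y a₁ a₂ b₁ b₂ → b₁ * (y * b₂ - a₂) - b₂ * (y * b₁ - a₁) ≡ a₁ * b₂ - a₂ * b₁
    identity = solve-∀

  det-skip-nextVertex : ∀ y a b → det a (nextVertex y a b) ≡ y * det a b
  det-skip-nextVertex y (a₁ , a₂) (b₁ , b₂) = identity y a₁ a₂ b₁ b₂
    where
    identity : ∀ y a₁ a₂ b₁ b₂ →
               a₁ * (y * b₂ - a₂) - a₂ * (y * b₁ - a₁) ≡ y * (a₁ * b₂ - a₂ * b₁)
    identity = solve-∀

  -- Cramer's rule det(a,b) c = det(a,c) b - det(b,c) a: along two consecutive edges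
  -- a → b → c the vertex c is determined by a, b and det(a,c).
  plücker : ∀ a b c → Unimodular n a b → Unimodular n b c →
            c ≋² nextVertex (det a c) a b [mod n ]
  plücker {n} (a₁ , a₂) (b₁ , b₂) (c₁ , c₂) ab bc =
    component a₁ b₁ c₁ (cramer₁ a₁ a₂ b₁ b₂ c₁ c₂) , component a₂ b₂ c₂ (cramer₂ a₁ a₂ b₁ b₂ c₁ c₂)
    where
    Δab Δac Δbc : ℤ
    Δab = det (a₁ , a₂) (b₁ , b₂)
    Δac = det (a₁ , a₂) (c₁ , c₂)
    Δbc = det (b₁ , b₂) (c₁ , c₂)
    cramer₁ : ∀ a₁ a₂ b₁ b₂ c₁ c₂ →
              (a₁ * b₂ - a₂ * b₁) * c₁ ≡ (a₁ * c₂ - a₂ * c₁) * b₁ - (b₁ * c₂ - b₂ * c₁) * a₁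
    cramer₁ = solve-∀
    cramer₂ : ∀ a₁ a₂ b₁ b₂ c₁ c₂ →
              (a₁ * b₂ - a₂ * b₁) * c₂ ≡ (a₁ * c₂ - a₂ * c₁) * b₂ - (b₁ * c₂ - b₂ * c₁) * a₂
    cramer₂ = solve-∀
    component : ∀ a b c → Δab * c ≡ Δac * b - Δbc * a → c ≋ Δac * b - a [mod n ]
    component a b c eq = begin
      c                  ≡⟨ ℤ.*-identityˡ c ⟨
      + 1 * c            ≈⟨ *-congʳ c ab ⟨
      Δab * c            ≡⟨ eq ⟩
      Δac * b - Δbc * a  ≈⟨ sub-congˡ (Δac * b) (*-congʳ a bc) ⟩
      Δac * b - + 1 * a  ≡⟨ cong (λ t → Δac * b - t) (ℤ.*-identityˡ a) ⟩
      Δac * b - a        ∎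
      where open ≋-Reasoning n

  det-den≡0 : ∀ u → proj₂ z ≋ + 0 [mod n ] → det u z ≋ - proj₂ u * proj₁ z [mod n ]
  det-den≡0 {z} {n} (u₁ , u₂) z₂≡0 = begin
    u₁ * proj₂ z - u₂ * proj₁ z  ≈⟨ sub-congʳ (u₂ * proj₁ z) (*-congˡ u₁ z₂≡0) ⟩
    u₁ * + 0 - u₂ * proj₁ z      ≡⟨ identity u₁ u₂ (proj₁ z) ⟩
    - u₂ * proj₁ z               ∎
    where
    open ≋-Reasoning n
    identity : ∀ u₁ u₂ z₁ → u₁ * + 0 - u₂ * z₁ ≡ - u₂ * z₁
    identity = solve-∀

  closing-unique : u ≋² u′ [mod n ] → Unimodular n u z → Unimodular n u′ z′ →
                   proj₂ z ≋ + 0 [mod n ] → proj₂ z′ ≋ + 0 [mod n ] → z ≋² z′ [mod n ]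
  closing-unique {u} {u′} {z′ = z′} (_ , u₂≡) uz u′z′ z₂≡0 z′₂≡0 =
    inverse-unique (- proj₂ u) (mod-trans (mod-sym (det-den≡0 u z₂≡0)) uz)
      (mod-trans (*-congʳ (proj₁ z′) (neg-cong u₂≡)) (mod-trans (mod-sym (det-den≡0 u′ z′₂≡0)) u′z′))
    , mod-trans z₂≡0 (mod-sym z′₂≡0)

  Path : ℕ → Vec ℤ² k → Set
  Path n = Linked (Unimodular n)

  Path-resp : ∀ {W W′ : Vec ℤ² (suc k)} → Pointwise _≋²_[mod n ] W W′ → Path n W → Path n W′
  Path-resp (_ ∷ [])           [-]         = [-]
  Path-resp (u≡ ∷ W≡@(v≡ ∷ _)) (uv ∷ path) =
    mod-trans (mod-sym (det-cong u≡ v≡)) uv ∷ Path-resp W≡ path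

  endpoint : ∀ {A : Set} → Vec A (suc k) → A
  endpoint {k} W = lookup W (fromℕ k)

  -- Membership in Xₘ(n) read on integer vectors: for a vertex, being equivalent to 1/0
  -- amounts to having denominator 0.
  record ClosedPath (n : ℕ) (W : Vec ℤ² (3 ℕ.+ k)) : Set where
    field
      path   : Path n W
      start₀ : lookup W zero ≋² 1/0 [mod n ]
      start₁ : lookup W (suc zero) ≋² 0/1 [mod n ]
      end    : proj₂ (endpoint W) ≋ + 0 [mod n ]

  ClosedPath-resp : ∀ {W W′ : Vec ℤ² (3 ℕ.+ k)} → Pointwise _≋²_[mod n ] W W′ →
                    ClosedPath n W → ClosedPath n W′
  ClosedPath-resp W≡@(a≡ ∷ b≡ ∷ _) W-closed = record
    { path   = Path-resp W≡ path
    ; start₀ = ≋²-trans (≋²-sym a≡) start₀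
    ; start₁ = ≋²-trans (≋²-sym b≡) start₁
    ; end    = mod-trans (mod-sym (proj₂ (Pointwise.lookup W≡ (fromℕ _)))) end
    }
    where open ClosedPath W-closed

  skipDets : Vec ℤ² (3 ℕ.+ k) → Vec ℤ k
  skipDets {zero}  _               = []
  skipDets {suc k} (a ∷ b ∷ c ∷ W) = det a c ∷ skipDets (b ∷ c ∷ W)

  skipDets-cong : ∀ {W W′ : Vec ℤ² (3 ℕ.+ k)} → Pointwise _≋²_[mod n ] W W′ →
                  Pointwise _≋_[mod n ] (skipDets W) (skipDets W′)
  skipDets-cong {zero}  _                   = []
  skipDets-cong {suc k} (a≡ ∷ b≡ ∷ c≡ ∷ W≡) = det-cong a≡ c≡ ∷ skipDets-cong (b≡ ∷ c≡ ∷ W≡)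

  walkFrom : (ℤ² → ℤ²) → ℤ² → ℤ² → Vec ℤ k → Vec ℤ² (suc k)
  walkFrom close a b []       = close b ∷ []
  walkFrom close a b (y ∷ ys) = nextVertex y a b ∷ walkFrom close b (nextVertex y a b) ys

  closedWalk : (ℤ² → ℤ²) → ℤ² → ℤ² → Vec ℤ k → Vec ℤ² (3 ℕ.+ k)
  closedWalk close a b ys = a ∷ b ∷ walkFrom close a b ys

  closedWalk-skipDets : ∀ close a b (ys : Vec ℤ k) → det a b ≡ + 1 →
                        skipDets (closedWalk close a b ys) ≡ ys
  closedWalk-skipDets close a b []       _    = refl
  closedWalk-skipDets close a b (y ∷ ys) ab≡1 =
    cong₂ _∷_ (trans (det-skip-nextVertex y a b) (trans (cong (y *_) ab≡1) (ℤ.*-identityʳ y)))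
              (closedWalk-skipDets close b (nextVertex y a b) ys (trans (det-nextVertex y a b) ab≡1))

  endpoint-walkFrom : ∀ (P : ℤ² → Set) {close} → (∀ u → P (close u)) →
                      ∀ a b (ys : Vec ℤ k) → P (endpoint (walkFrom close a b ys))
  endpoint-walkFrom P P-close a b []       = P-close b
  endpoint-walkFrom P P-close a b (y ∷ ys) = endpoint-walkFrom P P-close b (nextVertex y a b) ys

  module _ {d n : ℕ} (d∣n : d ℕ.∣ n) (close : ℤ² → ℤ²) (close-flat : ∀ u → proj₂ (close u) ≡ + 0)
           where

    closedWalk-lift-from :
      ∀ {V : Vec ℤ² (3 ℕ.+ k)} a b (ys : Vec ℤ k) →
      (∀ u → Unimodular d u (endpoint V) → Unimodular n u (close u)) →
      Path d V → proj₂ (endpoint V) ≋ + 0 [mod d ] →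
      det a b ≡ + 1 → a ≋² lookup V zero [mod d ] → b ≋² lookup V (suc zero) [mod d ] →
      Pointwise _≋_[mod d ] ys (skipDets V) →
      Path n (closedWalk close a b ys) × Pointwise _≋²_[mod d ] (closedWalk close a b ys) V
    closedWalk-lift-from {V = A ∷ B ∷ Z ∷ []} a b [] closes (_ ∷ BZ ∷ [-]) Z-flat ab≡1 a≡A b≡B [] =
      (mod-reflexive ab≡1 ∷ b-close ∷ [-]) ,
      (a≡A ∷ b≡B ∷ closing-unique b≡B (mod-weaken d∣n b-close) BZ (mod-reflexive (close-flat b)) Z-flat
           ∷ [])
      where
      b-close : Unimodular n b (close b)
      b-close = closes b (mod-trans (det-cong b≡B ≋²-refl) BZ)
    closedWalk-lift-from {V = A ∷ B ∷ C ∷ V} a b (y ∷ ys) closes (AB ∷ BCV) V-flat ab≡1 a≡A b≡B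
                         (y≡ ∷ ys≡) =
      (mod-reflexive ab≡1 ∷ proj₁ rest) , (a≡A ∷ proj₂ rest)
      where
      c : ℤ²
      c = nextVertex y a b
      c≡C : c ≋² C [mod d ]
      c≡C = ≋²-trans (nextVertex-cong y≡ a≡A b≡B) (≋²-sym (plücker A B C AB (Linked.head BCV)))
      rest : Path n (closedWalk close b c ys) ×
             Pointwise _≋²_[mod d ] (closedWalk close b c ys) (B ∷ C ∷ V)
      rest = closedWalk-lift-from b c ys closes BCV V-flat (trans (det-nextVertex y a b) ab≡1) b≡B c≡C ys≡

    closedWalk-lift :
      ∀ {V : Vec ℤ² (3 ℕ.+ k)} (ys : Vec ℤ k) →
      (∀ u → Unimodular d u (endpoint V) → Unimodular n u (close u)) →
      ClosedPath d V → Pointwise _≋_[mod d ] ys (skipDets V) →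
      ClosedPath n (closedWalk close 1/0 0/1 ys) × Pointwise _≋²_[mod d ] (closedWalk close 1/0 0/1 ys) V
    closedWalk-lift {V = V} ys closes V-closed ys≡ = W-closed , proj₂ lifted
      where
      open ClosedPath V-closed
      lifted : Path n (closedWalk close 1/0 0/1 ys) ×
               Pointwise _≋²_[mod d ] (closedWalk close 1/0 0/1 ys) V
      lifted = closedWalk-lift-from 1/0 0/1 ys closes path end refl (≋²-sym start₀) (≋²-sym start₁) ys≡
      W-closed : ClosedPath n (closedWalk close 1/0 0/1 ys)
      W-closed = record
        { path   = proj₁ lifted
        ; start₀ = ≋²-refl
        ; start₁ = ≋²-refl
        ; end    = mod-reflexive (endpoint-walkFrom (λ u → proj₂ u ≡ + 0) close-flat 1/0 0/1 ys)
        }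


module FareyGraph where

  open import Defs
  open import Data.Nat.Base as ℕ using (ℕ; zero; suc; NonZero)
  import Data.Nat.Divisibility as ℕ
  open import Data.Nat.GCD using (gcd; gcd[m,n]∣m; gcd[m,n]∣n; gcd-identityʳ)
  open import Data.Integer.Base using (ℤ; +_; _*_)
  import Data.Integer.Properties as ℤ
  import Data.Integer.Divisibility.Signed as Signed
  open import Data.Fin.Base using (Fin; zero; suc; toℕ; inject₁; fromℕ)
  open import Data.Vec.Base using (Vec; []; _∷_; lookup; map)
  import Data.Vec.Properties as Vec
  open import Data.Vec.Relation.Unary.Linked as Linked using (Linked; [-]; _∷_)
  import Data.Vec.Relation.Unary.Linked.Properties as Linkedₚ
  open import Data.Vec.Relation.Binary.Pointwise.Inductive using (Pointwise; []; _∷_)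
  open import Data.Product.Base using (_×_; _,_; proj₁; proj₂)
  open import Function.Base using (_∘_)
  open import Relation.Binary.PropositionalEquality
  open Congruence
  open UnimodularPaths

  private
    variable
      d k l n n′ : ℕ

  toℤ² : Pair n → ℤ²
  toℤ² v = num v , den v

  module _ {A : Set} {R : A → A → Set} where

    lookup-edges⇒Linked : ∀ {m} {w : Vec A (suc m)} →
      (∀ (i : Fin m) → R (lookup w (inject₁ i)) (lookup w (suc i))) → Linked R w
    lookup-edges⇒Linked {zero}  {x ∷ []}    _       = [-]
    lookup-edges⇒Linked {suc m} {x ∷ y ∷ w} R-edges = R-edges zero ∷ lookup-edges⇒Linked (R-edges ∘ suc)

    Linked⇒lookup-edges : ∀ {m} {w : Vec A (suc m)} →
      Linked R w → ∀ (i : Fin m) → R (lookup w (inject₁ i)) (lookup w (suc i))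
    Linked⇒lookup-edges {w = _ ∷ _ ∷ _} (r ∷ _)  zero    = r
    Linked⇒lookup-edges {w = _ ∷ _ ∷ _} (_ ∷ rs) (suc i) = Linked⇒lookup-edges rs i

  private
    ∣⇒∣+ : ∀ {d a} → d ℕ.∣ a → + d Signed.∣ + a
    ∣⇒∣+ = Signed.∣ᵤ⇒∣

  edge⇒vertexˡ : ∀ u v → Edge n u v → IsVertex n u
  edge⇒vertexˡ {n} u v uv = common-divisor≡1 (gcd[m,n]∣n g₀ n)
    (Signed.∣m∣n⇒∣m-n (Signed.∣m⇒∣m*n (den v) (∣⇒∣+ g∣a)) (Signed.∣m⇒∣m*n (num v) (∣⇒∣+ g∣b)))
    (mod uv)
    where
    a b g₀ : ℕ
    a = toℕ (proj₁ u)
    b = toℕ (proj₂ u)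
    g₀ = gcd a b
    g∣a : gcd g₀ n ℕ.∣ a
    g∣a = ℕ.∣-trans (gcd[m,n]∣m g₀ n) (gcd[m,n]∣m a b)
    g∣b : gcd g₀ n ℕ.∣ b
    g∣b = ℕ.∣-trans (gcd[m,n]∣m g₀ n) (gcd[m,n]∣n a b)

  edge⇒vertexʳ : ∀ u v → Edge n u v → IsVertex n v
  edge⇒vertexʳ {n} u v uv = common-divisor≡1 (gcd[m,n]∣n g₀ n)
    (Signed.∣m∣n⇒∣m-n (Signed.∣n⇒∣m*n (num u) (∣⇒∣+ g∣b)) (Signed.∣n⇒∣m*n (den u) (∣⇒∣+ g∣a)))
    (mod uv)
    where
    a b g₀ : ℕ
    a = toℕ (proj₁ v)
    b = toℕ (proj₂ v)
    g₀ = gcd a b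
    g∣a : gcd g₀ n ℕ.∣ a
    g∣a = ℕ.∣-trans (gcd[m,n]∣m g₀ n) (gcd[m,n]∣m a b)
    g∣b : gcd g₀ n ℕ.∣ b
    g∣b = ℕ.∣-trans (gcd[m,n]∣m g₀ n) (gcd[m,n]∣n a b)

  Linked⇒vertices : ∀ {w : Vec (Pair n) (2 ℕ.+ k)} → Linked (Edge n) w →
                    ∀ i → IsVertex n (lookup w i)
  Linked⇒vertices {w = u ∷ v ∷ _}     (uv ∷ _)   zero       = edge⇒vertexˡ u v uv
  Linked⇒vertices {w = u ∷ v ∷ []}    (uv ∷ [-]) (suc zero) = edge⇒vertexʳ u v uv
  Linked⇒vertices {w = _ ∷ _ ∷ _ ∷ _} (_ ∷ es)   (suc i)    = Linked⇒vertices es i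

  Is1/0⇒≋ : ∀ {a : Pair n} → Is1/0 n a → toℤ² a ≋² 1/0 [mod n ]
  Is1/0⇒≋ (a₁≡1 , a₂≡0) = mod a₁≡1 , mod-reflexive (cong +_ a₂≡0)

  ≋⇒Is1/0 : ∀ {a : Pair n} → toℤ² a ≋² 1/0 [mod n ] → Is1/0 n a
  ≋⇒Is1/0 (a₁≡1 , a₂≡0) = unmod a₁≡1 , toℕ-≡0-mod a₂≡0

  Is0/1⇒≋ : ∀ {a : Pair n} → Is0/1 n a → toℤ² a ≋² 0/1 [mod n ]
  Is0/1⇒≋ (a₁≡0 , a₂≡1) = mod-reflexive (cong +_ a₁≡0) , mod a₂≡1

  ≋⇒Is0/1 : ∀ {a : Pair n} → toℤ² a ≋² 0/1 [mod n ] → Is0/1 n a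
  ≋⇒Is0/1 (a₁≡0 , a₂≡1) = toℕ-≡0-mod a₁≡0 , unmod a₂≡1

  private
    *-den≡0 : ∀ c {a : Pair n} → toℤ² a ≋² 1/0 [mod n ] → c * den a ≋ + 0 [mod n ]
    *-den≡0 c (_ , a₂≡0) = mod-trans (*-congˡ c a₂≡0) (mod-reflexive (ℤ.*-zeroʳ c))

  Equiv⇒den≡0 : ∀ {a z : Pair n} → toℤ² a ≋² 1/0 [mod n ] → Equiv n z a → den z ≋ + 0 [mod n ]
  Equiv⇒den≡0 {n} {a} {z} a≋1/0 (c , _ , _ , z₂≡ca₂) = mod-trans z₂≡ca₂′ (*-den≡0 (+ toℕ c) a≋1/0)
    where
    z₂≡ca₂′ : den z ≋ + toℕ c * den a [mod n ]
    z₂≡ca₂′ = mod z₂≡ca₂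

  den≡0⇒Equiv : ∀ {a z : Pair n} → toℤ² a ≋² 1/0 [mod n ] → IsVertex n z →
                den z ≋ + 0 [mod n ] → Equiv n z a
  den≡0⇒Equiv {n} {a} {z} a≋1/0 z-vertex z₂≡0 = proj₁ z , z₁-unit , unmod z₁≡ca₁ , unmod z₂≡ca₂
    where
    c : ℤ
    c = + toℕ (proj₁ z)
    z₁-unit : gcd (toℕ (proj₁ z)) n ≡ 1
    z₁-unit = subst (λ t → gcd t n ≡ 1) (gcd-identityʳ (toℕ (proj₁ z)))
      (subst (λ t → gcd (gcd (toℕ (proj₁ z)) t) n ≡ 1) (toℕ-≡0-mod z₂≡0) z-vertex)
    z₁≡ca₁ : num z ≋ c * num a [mod n ]
    z₁≡ca₁ = mod-trans (mod-reflexive (sym (ℤ.*-identityʳ c))) (mod-sym (*-congˡ c (proj₁ a≋1/0)))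
    z₂≡ca₂ : den z ≋ c * den a [mod n ]
    z₂≡ca₂ = mod-trans z₂≡0 (mod-sym (*-den≡0 c a≋1/0))

  InX⇒ClosedPath : ∀ {1≤m} (w : Vec (Pair n) (3 ℕ.+ k)) → InX n (2 ℕ.+ k) 1≤m w →
                   ClosedPath n (map toℤ² w)
  InX⇒ClosedPath {n} w@(_ ∷ _ ∷ _) ((_ , edges) , a-1/0 , b-0/1 , z~a) = record
    { path   = Linkedₚ.map⁺ (Linked.map mod (lookup-edges⇒Linked edges))
    ; start₀ = Is1/0⇒≋ a-1/0
    ; start₁ = Is0/1⇒≋ b-0/1
    ; end    = subst (λ z → proj₂ z ≋ + 0 [mod n ]) (sym (Vec.lookup-map (fromℕ _) toℤ² w))
                 (Equiv⇒den≡0 (Is1/0⇒≋ a-1/0) z~a)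
    }

  ClosedPath⇒InX : ∀ {1≤m} {w : Vec (Pair n) (3 ℕ.+ k)} → ClosedPath n (map toℤ² w) →
                   InX n (2 ℕ.+ k) 1≤m w
  ClosedPath⇒InX {n} {w = w@(_ ∷ _ ∷ _)} w-closed =
    (vertices , Linked⇒lookup-edges edges) , ≋⇒Is1/0 start₀ , ≋⇒Is0/1 start₁ ,
    den≡0⇒Equiv start₀ (vertices (fromℕ _))
      (subst (λ z → proj₂ z ≋ + 0 [mod n ]) (Vec.lookup-map (fromℕ _) toℤ² w) end)
    where
    open ClosedPath w-closed
    edges : Linked (Edge n) w
    edges = Linked.map unmod (Linkedₚ.map⁻ path)
    vertices : ∀ i → IsVertex n (lookup w i)
    vertices = Linked⇒vertices edges

  InX₁⇒∣1 : ∀ {1≤m} (v : Vec (Pair n) 2) → InX n 1 1≤m v → n ℕ.∣ 1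
  InX₁⇒∣1 (_ ∷ _ ∷ []) (_ , a-1/0 , b-0/1 , b~a) =
    unmod (mod-trans (mod-sym (proj₂ (Is0/1⇒≋ b-0/1))) (Equiv⇒den≡0 (Is1/0⇒≋ a-1/0) b~a))

  private
    _≡ᵖ_[mod_] : Pair n → Pair n′ → ℕ → Set
    u ≡ᵖ v [mod d ] = (num u ≡ num v [mod d ]) × (den u ≡ den v [mod d ])

  reduces⇒pointwise : ∀ {w : Vec (Pair n) l} {v : Vec (Pair n′) l} →
                      (∀ i → lookup w i ≡ᵖ lookup v i [mod d ]) →
                      Pointwise _≋²_[mod d ] (map toℤ² w) (map toℤ² v)
  reduces⇒pointwise {w = []}    {[]}    _   = []
  reduces⇒pointwise {w = _ ∷ _} {_ ∷ _} w≡v =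
    (mod (proj₁ (w≡v zero)) , mod (proj₂ (w≡v zero))) ∷ reduces⇒pointwise (w≡v ∘ suc)

  pointwise⇒reduces : ∀ {w : Vec (Pair n) l} {v : Vec (Pair n′) l} →
                      Pointwise _≋²_[mod d ] (map toℤ² w) (map toℤ² v) →
                      ∀ i → lookup w i ≡ᵖ lookup v i [mod d ]
  pointwise⇒reduces {w = _ ∷ _} {_ ∷ _} ((x₁≡ , x₂≡) ∷ _) zero    = unmod x₁≡ , unmod x₂≡
  pointwise⇒reduces {w = _ ∷ _} {_ ∷ _} (_ ∷ w≡v)         (suc i) = pointwise⇒reduces w≡v i

  pointwise⇒≡ : ∀ {w w′ : Vec (Pair n) l} → Pointwise _≋²_[mod n ] (map toℤ² w) (map toℤ² w′) →
                w ≡ w′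
  pointwise⇒≡ {w = []}    {[]}    []                    = refl
  pointwise⇒≡ {w = _ ∷ _} {_ ∷ _} ((x₁≡ , x₂≡) ∷ w≡w′) =
    cong₂ _∷_ (cong₂ _,_ (toℕ-injective-mod x₁≡) (toℕ-injective-mod x₂≡)) (pointwise⇒≡ w≡w′)

  reduce² : ∀ n .{{_ : NonZero n}} → ℤ² → Pair n
  reduce² n u = reduce n (proj₁ u) , reduce n (proj₂ u)

  map-reduce² : ∀ n .{{_ : NonZero n}} (W : Vec ℤ² l) →
                Pointwise _≋²_[mod n ] (map toℤ² (map (reduce² n) W)) W
  map-reduce² n []      = []
  map-reduce² n (u ∷ W) = (reduce-≋ n (proj₁ u) , reduce-≋ n (proj₂ u)) ∷ map-reduce² n W


module FunctionEnumeration where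

  open import Data.Nat.Base using (ℕ; zero; suc; _^_)
  open import Data.Fin.Base using (Fin; zero; suc; combine; funToFin; finToFun)
  import Data.Fin.Properties as Finₚ
  open import Data.List.Base using (List; map; length; allFin)
  import Data.List.Properties as List
  open import Data.List.Relation.Unary.All using (All)
  import Data.List.Relation.Unary.All.Properties as All
  open import Data.List.Relation.Unary.Unique.Propositional using (Unique)
  import Data.List.Relation.Unary.Unique.Propositional.Properties as Unique
  open import Data.List.Membership.Propositional using (_∈_)
  import Data.List.Membership.Propositional.Properties as ∈
  open import Function.Base using (_∘_)
  open import Relation.Binary.PropositionalEquality

  private
    variable
      k q : ℕ

  funToFin-cong : ∀ {f g : Fin k → Fin q} → f ≗ g → funToFin f ≡ funToFin g
  funToFin-cong {zero}  _   = refl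
  funToFin-cong {suc k} f≗g = cong₂ combine (f≗g zero) (funToFin-cong (f≗g ∘ suc))

  module _ {A : Set} (F : (Fin k → Fin q) → A) where

    enumerate : List A
    enumerate = map (F ∘ finToFun) (allFin (q ^ k))

    enumerate-length : length enumerate ≡ q ^ k
    enumerate-length = trans (List.length-map (F ∘ finToFun) (allFin _)) (List.length-tabulate _)

    enumerate-unique : (∀ {f g} → F f ≡ F g → f ≗ g) → Unique enumerate
    enumerate-unique F-injective = Unique.map⁺ finToFun-injective (Unique.allFin⁺ _)
      where
      finToFun-injective : ∀ {i j} → F (finToFun i) ≡ F (finToFun j) → i ≡ j
      finToFun-injective {i} {j} eq = begin
        i                              ≡⟨ Finₚ.funToFin-finToFin {k} {q} i ⟨
        funToFin {k} {q} (finToFun i)  ≡⟨ funToFin-cong (F-injective eq) ⟩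
        funToFin {k} {q} (finToFun j)  ≡⟨ Finₚ.funToFin-finToFin {k} {q} j ⟩
        j                              ∎
        where open ≡-Reasoning

    enumerate-complete : (∀ {f g} → f ≗ g → F f ≡ F g) → ∀ f → F f ∈ enumerate
    enumerate-complete F-cong f = subst (_∈ enumerate) (F-cong (Finₚ.finToFun-funToFin f))
      (∈.∈-map⁺ (F ∘ finToFun) (∈.∈-allFin (funToFin f)))

    enumerate-all : ∀ {P : A → Set} → (∀ f → P (F f)) → All P enumerate
    enumerate-all P-F = All.map⁺ (All.tabulate⁺ (P-F ∘ finToFun))


module Lifting where

  open import Defs
  open import Data.Nat.Base as ℕ using (ℕ; suc; NonZero; _≤_; _^_)
  import Data.Nat.Properties as ℕ
  import Data.Nat.Divisibility as ℕ
  open import Data.Integer.Base using (ℤ; +_; _+_; _-_; _*_; -_)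
  open import Data.Integer.Tactic.RingSolver using (solve-∀)
  open import Data.Fin.Base using (Fin; toℕ; fromℕ)
  open import Data.Vec.Base using (Vec; lookup; map; tabulate)
  import Data.Vec.Properties as Vec
  open import Data.Vec.Relation.Binary.Pointwise.Inductive as Pointwise using (Pointwise)
  open import Data.List.Base using (List; length)
  open import Data.List.Relation.Unary.All using (All)
  open import Data.List.Relation.Unary.Unique.Propositional using (Unique)
  open import Data.List.Membership.Propositional using (_∈_)
  open import Data.Product.Base using (Σ; Σ-syntax; _×_; _,_; proj₁; proj₂)
  open import Relation.Binary.PropositionalEquality
  open Congruence
  open UnimodularPaths
  open FareyGraph
  open FunctionEnumeration

  tabulate-lookup⁺ : ∀ {A B : Set} {R : A → B → Set} {k} {g : Fin k → A} {xs : Vec B k} →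
                     (∀ j → R (g j) (lookup xs j)) → Pointwise R (tabulate g) xs
  tabulate-lookup⁺ {R = R} {g = g} {xs} R-g =
    subst (Pointwise R (tabulate g)) (Vec.tabulate∘lookup xs) (Pointwise.tabulate⁺ R-g)

  module _ (p : ℕ) .{{_ : NonZero p}} (r k : ℕ) {1≤m : 1 ≤ 2 ℕ.+ k}
           (v : Vec (Pair p) (3 ℕ.+ k)) (v∈X : InX p (2 ℕ.+ k) 1≤m v) where

    private
      q N : ℕ
      q = p ^ r
      N = p ^ suc r

      instance
        q≢0 : NonZero q
        q≢0 = ℕ.m^n≢0 p r
        N≢0 : NonZero N
        N≢0 = ℕ.m^n≢0 p (suc r)

      p∣N : p ℕ.∣ N
      p∣N = ℕ.m∣m*n q

      V : Vec ℤ² (3 ℕ.+ k)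
      V = map toℤ² v
      V-closed : ClosedPath p V
      V-closed = InX⇒ClosedPath {1≤m = 1≤m} v v∈X
      X : Vec ℤ k
      X = skipDets V

      s₀ : ℤ
      s₀ = - proj₁ (endpoint V)

    -- The closing vertex (-b⁻¹, 0) after u = (a, b): modulo p the last edge of v says that
    -- s₀ inverts b, and liftInverse turns s₀ into an inverse modulo N.
    close : ℤ² → ℤ²
    close u = - liftInverse (proj₂ u) s₀ (suc r) , + 0

    close-unimodular : ∀ {d Z} → p ℕ.∣ d → proj₂ Z ≋ + 0 [mod d ] →
                       proj₁ Z ≋ proj₁ (endpoint V) [mod p ] →
                       ∀ u → Unimodular d u Z → Unimodular N u (close u)
    close-unimodular {Z = Z} p∣d Z₂≡0 Z₁≡ u@(u₁ , u₂) uZ = begin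
      u₁ * + 0 - u₂ * (- t)  ≡⟨ identity u₁ u₂ t ⟩
      u₂ * t                 ≈⟨ liftInverse-inverts u₂ s₀ u₂s₀≡1 (suc r) ⟩
      + 1                    ∎
      where
      open ≋-Reasoning N
      t : ℤ
      t = liftInverse u₂ s₀ (suc r)
      identity : ∀ u₁ u₂ t → u₁ * + 0 - u₂ * (- t) ≡ u₂ * t
      identity = solve-∀
      identity′ : ∀ u₂ z → u₂ * (- z) ≡ - u₂ * z
      identity′ = solve-∀
      -u₂Z₁≡1 : - u₂ * proj₁ Z ≋ + 1 [mod p ]
      -u₂Z₁≡1 = mod-weaken p∣d (mod-trans (mod-sym (det-den≡0 u Z₂≡0)) uZ)
      u₂s₀≡1 : u₂ * s₀ ≋ + 1 [mod p ]
      u₂s₀≡1 = mod-trans (mod-reflexive (identity′ u₂ (proj₁ (endpoint V))))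
        (mod-trans (*-congˡ (- u₂) (mod-sym Z₁≡)) -u₂Z₁≡1)

    params : (Fin k → Fin q) → Vec ℤ k
    params f = tabulate λ j → lookup X j + + p * + toℕ (f j)

    walk : (Fin k → Fin q) → Vec ℤ² (3 ℕ.+ k)
    walk f = closedWalk close 1/0 0/1 (params f)

    lift : (Fin k → Fin q) → Vec (Pair N) (3 ℕ.+ k)
    lift f = map (reduce² N) (walk f)

    params≋X : ∀ f → Pointwise _≋_[mod p ] (params f) X
    params≋X f = tabulate-lookup⁺ λ j → +-multiple (lookup X j) (+ toℕ (f j))

    walk-lifts : ∀ f → ClosedPath N (walk f) × Pointwise _≋²_[mod p ] (walk f) V
    walk-lifts f = closedWalk-lift p∣N close (λ _ → refl) (params f)
      (close-unimodular ℕ.∣-refl (ClosedPath.end V-closed) mod-refl) V-closed (params≋X f)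

    lift-isLift : ∀ f → IsLift p (suc r) (2 ℕ.+ k) 1≤m v (lift f)
    lift-isLift f =
      ClosedPath⇒InX {1≤m = 1≤m} (ClosedPath-resp (Pointwise.sym ≋²-sym lift≋walk) (proj₁ (walk-lifts f))) ,
      pointwise⇒reduces (Pointwise.trans ≋²-trans (Pointwise.map (≋²-weaken p∣N) lift≋walk)
                                                   (proj₂ (walk-lifts f)))
      where
      lift≋walk : Pointwise _≋²_[mod N ] (map toℤ² (lift f)) (walk f)
      lift≋walk = map-reduce² N (walk f)

    lift-skipDets : ∀ f → Pointwise _≋_[mod N ] (skipDets (map toℤ² (lift f))) (params f)
    lift-skipDets f = subst (Pointwise _≋_[mod N ] _) (closedWalk-skipDets close 1/0 0/1 (params f) refl)
      (skipDets-cong (map-reduce² N (walk f)))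

    lift-injective : ∀ {f g} → lift f ≡ lift g → f ≗ g
    lift-injective {f} {g} eq j =
      digit-injective p (lookup X j) (Pointwise.tabulate⁻ params-f≋params-g j)
      where
      params-f≋params-g : Pointwise _≋_[mod N ] (params f) (params g)
      params-f≋params-g = Pointwise.trans mod-trans (Pointwise.sym mod-sym (lift-skipDets f))
        (subst (λ w → Pointwise _≋_[mod N ] (skipDets (map toℤ² w)) (params g)) (sym eq) (lift-skipDets g))

    lift-cong : ∀ {f g} → f ≗ g → lift f ≡ lift g
    lift-cong f≗g = cong (λ ys → map (reduce² N) (closedWalk close 1/0 0/1 ys))
      (Vec.tabulate-cong λ j → cong (λ t → lookup X j + + p * + toℕ t) (f≗g j))

    lift-complete : ∀ w → IsLift p (suc r) (2 ℕ.+ k) 1≤m v w → Σ (Fin k → Fin q) λ f → lift f ≡ w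
    lift-complete w (w∈X , w≡v) =
      f , pointwise⇒≡ (Pointwise.trans ≋²-trans (map-reduce² N (walk f)) walk≋W)
      where
      W : Vec ℤ² (3 ℕ.+ k)
      W = map toℤ² w
      W-closed : ClosedPath N W
      W-closed = InX⇒ClosedPath {1≤m = 1≤m} w w∈X
      W≋V : Pointwise _≋²_[mod p ] W V
      W≋V = reduces⇒pointwise w≡v
      digits : ∀ j → Σ[ t ∈ Fin q ] lookup (skipDets W) j ≋ lookup X j + + p * + toℕ t [mod N ]
      digits j = digit q (Pointwise.lookup (skipDets-cong W≋V) j)
      f : Fin k → Fin q
      f j = proj₁ (digits j)
      -- With d = N, closedWalk-lift says that W is determined by its skip determinants.
      walk≋W : Pointwise _≋²_[mod N ] (walk f) W
      walk≋W = proj₂ (closedWalk-lift ℕ.∣-refl close (λ _ → refl) (params f)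
        (close-unimodular p∣N (ClosedPath.end W-closed) (proj₁ (Pointwise.lookup W≋V (fromℕ _))))
        W-closed (tabulate-lookup⁺ λ j → mod-sym (proj₂ (digits j))))

    enumerate-lifts : Σ (List (Vec (Pair N) (3 ℕ.+ k))) λ ws
                      → Unique ws
                      × All (IsLift p (suc r) (2 ℕ.+ k) 1≤m v) ws
                      × (∀ w → IsLift p (suc r) (2 ℕ.+ k) 1≤m v w → w ∈ ws)
                      × length ws ≡ q ^ k
    enumerate-lifts =
      enumerate lift , enumerate-unique lift lift-injective , enumerate-all lift lift-isLift ,
      complete , enumerate-length lift
      where
      complete : ∀ w → IsLift p (suc r) (2 ℕ.+ k) 1≤m v w → w ∈ enumerate lift
      complete w w-lift = let f , lift-f≡w = lift-complete w w-lift in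
        subst (_∈ enumerate lift) lift-f≡w (enumerate-complete lift lift-cong f)


open import Defs
open import Data.Nat using (ℕ; suc; _≤_; _∸_; _*_; _^_)
open import Data.Nat.Primality using (Prime)
open import Data.Vec using (Vec)
open import Data.List using (List; length)
open import Data.List.Relation.Unary.All using (All)
open import Data.List.Relation.Unary.Unique.Propositional using (Unique)
open import Data.List.Membership.Propositional using (_∈_)
open import Data.Product using (Σ; _×_)
open import Relation.Binary.PropositionalEquality using (_≡_)

open import Data.Nat.Properties using (^-*-assoc)
open import Data.Nat.Divisibility using (∣1⇒≡1)
open import Data.Nat.Primality using (¬prime[1]; prime⇒nonZero)
open import Data.Product using (_,_)
open import Relation.Nullary using (contradiction)
open import Relation.Binary.PropositionalEquality using (subst; trans)
open FareyGraph using (InX₁⇒∣1)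
open Lifting using (enumerate-lifts)

lemma3 : (p r m : ℕ) → Prime p → 1 ≤ r → (1≤m : 1 ≤ m)
         → (v : Vec (Pair p) (suc m)) → InX p m 1≤m v
         → Σ (List (Vec (Pair (p ^ r)) (suc m))) λ ws
             → Unique ws
             × All (IsLift p r m 1≤m v) ws
             × (∀ w → IsLift p r m 1≤m v w → w ∈ ws)
             × length ws ≡ p ^ ((r ∸ 1) * (m ∸ 2))
lemma3 p (suc r) 1 p-prime _ 1≤m v v∈X =
  contradiction (subst Prime (∣1⇒≡1 (InX₁⇒∣1 {1≤m = 1≤m} v v∈X)) p-prime) ¬prime[1]
lemma3 p (suc r) (suc (suc k)) p-prime _ 1≤m v v∈X =
  let ws , unique , lifts , complete , length≡ =
        enumerate-lifts p {{prime⇒nonZero p-prime}} r k {1≤m} v v∈X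
  in ws , unique , lifts , complete , trans length≡ (^-*-assoc p r k)
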